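{- Let $n\ge 0$ and $k\ge 0$ be integers. Let $\overline{RA}_{n+2,k}$ be the set of permutations $\pi\in\mathcal{Q}_{n+2}$ with $\mathrm{asc}(\pi)=k$ such that, with $a=\pi^{ -1}(1)$, either $a=n+2$, or $2\le a\le n+1$ and $\pi(a-1)<\pi(a+1)$. Let $RFA_{n+1,k}$ be the set of pairs $[\sigma,i]$ with $\sigma\in\mathcal{Q}_{n+1}$, $\mathrm{asc}(\sigma)=k$, $i\in\{1,\dots,k\}\cup\{n+1\}$ and $i>\sigma^{ -1}(n+1)-1$. Then there is a bijection from $\overline{RA}_{n+2,k}$ onto $RFA_{n+1,k}$.
   Context: Permutations of $[m]=\{1,\dots,m\}$ are written as words $\pi(1)\cdots\pi(m)$. $\mathrm{asc}(\pi)$ is the number of indices $i\in[m-1]$ with $\pi(i)<\pi(i+1)$. $\mathcal{Q}_m$ denotes the set of permutations $\pi$ of $[m]$ such that $\pi(1)<\pi(2)<\cdots<\pi(p)$ where $p=\pi^{ -1}(m)$ (the identity permutation being included). -}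

module Defs where

open import Data.Nat using (ℕ; zero; suc; _+_; _∸_; _≤_; _<_)
open import Data.Nat.Properties using (_≟_; _<?_; _≤?_)
open import Data.List using (List; []; _∷_; length; map; upTo; filter)
open import Data.List.Relation.Unary.All using (All)
open import Data.List.Relation.Unary.All using (all?)
open import Data.List.Relation.Unary.Unique.Propositional using (Unique)
open import Data.List.Relation.Unary.Unique.DecPropositional _≟_ using (unique?)
open import Data.Product using (_×_; _,_; Σ)
open import Data.Sum using (_⊎_)
open import Relation.Nullary using (Dec; yes; no)
open import Relation.Nullary.Decidable using (_×-dec_; _⊎-dec_; True)
open import Relation.Binary.PropositionalEquality using (_≡_)

-- A permutation of [m] is represented by its word π(1)⋯π(m), a list of naturals.

-- 1-based letter access: w ! i = π(i)  (0 if i is out of range)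
_!_ : List ℕ → ℕ → ℕ
[]           ! _             = 0
(x ∷ xs)     ! zero          = 0
(x ∷ xs)     ! suc zero      = x
(x ∷ xs)     ! suc (suc i)   = xs ! suc i

-- 1-based position of the first occurrence of v in w: pos v π = π⁻¹(v)  (0 if absent)
pos : ℕ → List ℕ → ℕ
pos v []       = 0
pos v (x ∷ xs) with x ≟ v
... | yes _ = 1
... | no  _ = suc (pos v xs)

oneTo : ℕ → List ℕ
oneTo r = map suc (upTo r)

IsPerm : ℕ → List ℕ → Set
IsPerm m w = length w ≡ m × All (λ x → 1 ≤ x × x ≤ m) w × Unique w

asc : ℕ → List ℕ → ℕ
asc m w = length (filter (λ i → (w ! i) <? (w ! suc i)) (oneTo (m ∸ 1)))

InQ : ℕ → List ℕ → Set
InQ m w = IsPerm m w × All (λ i → (w ! i) < (w ! suc i)) (oneTo (pos m w ∸ 1))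

RAbar : ℕ → ℕ → List ℕ → Set
RAbar n k w =
  InQ (n + 2) w × asc (n + 2) w ≡ k ×
  (pos 1 w ≡ n + 2 ⊎
   (2 ≤ pos 1 w × pos 1 w ≤ n + 1 × (w ! (pos 1 w ∸ 1)) < (w ! suc (pos 1 w))))

RFA : ℕ → ℕ → List ℕ × ℕ → Set
RFA n k (σ , i) =
  InQ (n + 1) σ × asc (n + 1) σ ≡ k ×
  ((1 ≤ i × i ≤ k) ⊎ i ≡ n + 1) × (pos (n + 1) σ ∸ 1) < i

-- decision procedures (so that the subsets below carry proof-irrelevant membership)
isPerm? : ∀ m w → Dec (IsPerm m w)
isPerm? m w = (length w ≟ m) ×-dec (all? (λ x → (1 ≤? x) ×-dec (x ≤? m)) w ×-dec unique? w)

inQ? : ∀ m w → Dec (InQ m w)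
inQ? m w = isPerm? m w ×-dec all? (λ i → (w ! i) <? (w ! suc i)) (oneTo (pos m w ∸ 1))

RAbar? : ∀ n k w → Dec (RAbar n k w)
RAbar? n k w =
  inQ? (n + 2) w ×-dec (asc (n + 2) w ≟ k) ×-dec
  ((pos 1 w ≟ n + 2) ⊎-dec
   ((2 ≤? pos 1 w) ×-dec (pos 1 w ≤? n + 1) ×-dec ((w ! (pos 1 w ∸ 1)) <? (w ! suc (pos 1 w)))))

RFA? : ∀ n k p → Dec (RFA n k p)
RFA? n k (σ , i) =
  inQ? (n + 1) σ ×-dec (asc (n + 1) σ ≟ k) ×-dec
  (((1 ≤? i) ×-dec (i ≤? k)) ⊎-dec (i ≟ n + 1)) ×-dec ((pos (n + 1) σ ∸ 1) <? i)

RAbarSet : ℕ → ℕ → Set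
RAbarSet n k = Σ (List ℕ) (λ w → True (RAbar? n k w))

RFASet : ℕ → ℕ → Set
RFASet n k = Σ (List ℕ × ℕ) (λ p → True (RFA? n k p))

-- Deleting the letter 1 from π and decrementing the other letters gives σ ∈ Q_{n+1}: since 1 is
-- not the first letter of π, it is not in the increasing prefix ending at n+2. If 1 is the last
-- letter, only the descent into it is lost, so asc σ = asc π, and π is sent to [σ, n+1].
-- Otherwise π(a-1) > 1 < π(a+1) with π(a-1) < π(a+1), and deleting 1 trades the ascent 1 π(a+1)
-- for the ascent π(a-1) π(a+1); so again asc σ = asc π, and π is sent to [σ, i] where i is the rank
-- of this ascent among the ascents of σ. The ascent comes after the letter n+1 of σ, which is the
-- condition i > σ⁻¹(n+1) - 1. The inverse increments the letters of σ and puts 1 at the end when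
-- i = n+1, and inside the i-th ascent otherwise.

module Submission where

open import Defs
open import Data.Nat using (ℕ; zero; suc; _+_; _∸_; _≤_; _<_; _<ᵇ_; z≤n; s≤s; pred)
open import Data.Nat.Properties
open import Data.Bool using (Bool; true; false; if_then_else_)
open import Data.Bool.Properties using (T-irrelevant)
open import Data.Empty using (⊥-elim)
open import Data.List using (List; []; _∷_; length; map; upTo; filter; _++_)
open import Data.List.Properties using (length-map; length-++; length-upTo; map-upTo; length-removeAt′; map-∘; map-id)
open import Data.List.Relation.Unary.All using (All; []; _∷_)
import Data.List.Relation.Unary.All as All
import Data.List.Relation.Unary.All.Properties as All
open import Data.List.Relation.Unary.Any using (here; there; _─_)
open import Data.List.Membership.Propositional using (_∈_)
open import Data.List.Membership.Propositional.Properties using (∈-map⁺; ∈-upTo⁺)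
open import Data.List.Membership.DecPropositional _≟_ using (_∈?_)
open import Data.List.Relation.Unary.Unique.Propositional using (Unique; []; _∷_)
import Data.List.Relation.Unary.Unique.Propositional.Properties as Unique
open import Data.Product using (_×_; _,_; proj₁; proj₂)
open import Data.Sum using (_⊎_; inj₁; inj₂)
open import Function using (_∘_)
open import Function.Bundles using (_⇔_; mk⇔; Equivalence; _⤖_; mk↔ₛ′)
open import Function.Properties.Inverse using (↔⇒⤖)
open import Relation.Nullary using (yes; no; does; ¬_)
open import Relation.Nullary.Decidable using (True; toWitness; fromWitness; dec-true; dec-false)
open import Relation.Nullary.Reflects using (ofʸ; ofⁿ)
open import Relation.Unary using (Decidable)
open import Relation.Binary.PropositionalEquality

<ᵇ-true : ∀ {x y} → x < y → (x <ᵇ y) ≡ true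
<ᵇ-true {x} {y} = dec-true (x <? y)

<ᵇ-false : ∀ {x y} → ¬ x < y → (x <ᵇ y) ≡ false
<ᵇ-false {x} {y} = dec-false (x <? y)

sucIf : Bool → ℕ → ℕ
sucIf b n = if b then suc n else n

sucIf-mono-≤ : ∀ b {m n} → m ≤ n → sucIf b m ≤ sucIf b n
sucIf-mono-≤ true  = s≤s
sucIf-mono-≤ false m≤n = m≤n

sucIf-positive : ∀ b {n} → 1 ≤ n → 1 ≤ sucIf b n
sucIf-positive true  _ = s≤s z≤n
sucIf-positive false 1≤n = 1≤n

pred-≢ : ∀ {a b} → 1 ≤ a → 1 ≤ b → a ≢ b → pred a ≢ pred b
pred-≢ {suc a} {suc b} _ _ a≢b = a≢b ∘ cong suc

≤⇒∸1< : ∀ {p q} → 1 ≤ q → p ≤ q → p ∸ 1 < q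
≤⇒∸1< {zero}  1≤q _   = 1≤q
≤⇒∸1< {suc p} _   p<q = p<q

∸1<⇒≤ : ∀ {p i} → p ∸ 1 < i → p ≤ i
∸1<⇒≤ {zero}  _   = z≤n
∸1<⇒≤ {suc p} p<i = p<i

oneTo-suc : ∀ r → oneTo (suc r) ≡ 1 ∷ map suc (oneTo r)
oneTo-suc r = cong (λ is → 1 ∷ map suc is) (sym (map-upTo suc r))

length-oneTo : ∀ m → length (oneTo m) ≡ m
length-oneTo m = trans (length-map suc (upTo m)) (length-upTo m)

pos-∷ : ∀ m y ys → pos m (y ∷ ys) ≡ suc (pos m (y ∷ ys) ∸ 1)
pos-∷ m y ys with y ≟ m
... | yes _ = refl
... | no  _ = refl

pos-∷-≢ : ∀ {v y} ys → y ≢ v → pos v (y ∷ ys) ≡ suc (pos v ys)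
pos-∷-≢ {v} {y} ys y≢v with y ≟ v
... | yes y≡v = ⊥-elim (y≢v y≡v)
... | no  _   = refl

1≤pos-∷ : ∀ v y ys → 1 ≤ pos v (y ∷ ys)
1≤pos-∷ v y ys = subst (1 ≤_) (sym (pos-∷ v y ys)) (s≤s z≤n)

pos≤length : ∀ v w → pos v w ≤ length w
pos≤length v [] = z≤n
pos≤length v (y ∷ ys) with y ≟ v
... | yes _ = s≤s z≤n
... | no  _ = s≤s (pos≤length v ys)

!-∷ : ∀ x v q → 1 ≤ q → (x ∷ v) ! suc q ≡ v ! q
!-∷ x v (suc q) _ = refl


-- Ascents

-- ascentsFrom x ys is the number of ascents of the word x ∷ ys. The same convention, passing the
-- letter that precedes the list, is used by ascentIndexFrom, insertOneFrom, IncreasingUpTo and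
-- OneInAscent.
ascentsFrom : ℕ → List ℕ → ℕ
ascentsFrom x [] = 0
ascentsFrom x (y ∷ ys) = sucIf (x <ᵇ y) (ascentsFrom y ys)

ascents : List ℕ → ℕ
ascents [] = 0
ascents (x ∷ xs) = ascentsFrom x xs

ascentsAt : List ℕ → List ℕ → ℕ
ascentsAt w is = length (filter (λ i → (w ! i) <? (w ! suc i)) is)

ascentsAt-∷ : ∀ x w is → ascentsAt (x ∷ w) (map suc (map suc is)) ≡ ascentsAt w (map suc is)
ascentsAt-∷ x w [] = refl
ascentsAt-∷ x w (i ∷ is) with does ((w ! suc i) <? (w ! suc (suc i)))
... | true  = cong suc (ascentsAt-∷ x w is)
... | false = ascentsAt-∷ x w is

ascentsAt-1∷ : ∀ x y r is → ascentsAt (x ∷ y ∷ r) (map suc (map suc is)) ≡ ascentsFrom y r →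
               ascentsAt (x ∷ y ∷ r) (1 ∷ map suc (map suc is)) ≡ ascentsFrom x (y ∷ r)
ascentsAt-1∷ x y r is tail with x <ᵇ y
... | true  = cong suc tail
... | false = tail

ascentsAt-oneTo : ∀ w → ascentsAt w (oneTo (length w ∸ 1)) ≡ ascents w
ascentsAt-oneTo [] = refl
ascentsAt-oneTo (x ∷ []) = refl
ascentsAt-oneTo (x ∷ y ∷ r) =
  trans (cong (ascentsAt (x ∷ y ∷ r)) (oneTo-suc (length r)))
        (ascentsAt-1∷ x y r (upTo (length r))
          (trans (ascentsAt-∷ x (y ∷ r) (upTo (length r))) (ascentsAt-oneTo (y ∷ r))))

asc≡ascents : ∀ {m} w → length w ≡ m → asc m w ≡ ascents w
asc≡ascents w refl = ascentsAt-oneTo w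

ascentsFrom≤length : ∀ x ys → ascentsFrom x ys ≤ length ys
ascentsFrom≤length x [] = z≤n
ascentsFrom≤length x (y ∷ ys) with x <ᵇ y
... | true  = s≤s (ascentsFrom≤length y ys)
... | false = m≤n⇒m≤1+n (ascentsFrom≤length y ys)

ascentsFrom-map-suc : ∀ a s → ascentsFrom (suc a) (map suc s) ≡ ascentsFrom a s
ascentsFrom-map-suc a [] = refl
ascentsFrom-map-suc a (b ∷ s) = cong (sucIf (a <ᵇ b)) (ascentsFrom-map-suc b s)


-- The increasing prefix of a word in Q_m

AscentAt : List ℕ → ℕ → Set
AscentAt w i = (w ! i) < (w ! suc i)

IncreasingBefore : ℕ → List ℕ → Set
IncreasingBefore m w = All (AscentAt w) (oneTo (pos m w ∸ 1))

data IncreasingUpTo (m : ℕ) : ℕ → List ℕ → Set where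
  []    : ∀ {x} → IncreasingUpTo m x []
  atMax : ∀ {ys} → IncreasingUpTo m m ys
  _∷_   : ∀ {x y ys} → x < y → IncreasingUpTo m y ys → IncreasingUpTo m x (y ∷ ys)

All-AscentAt-oneTo-suc : ∀ x y ys q →
  All (AscentAt (x ∷ y ∷ ys)) (oneTo (suc q)) ⇔ (x < y × All (AscentAt (y ∷ ys)) (oneTo q))
All-AscentAt-oneTo-suc x y ys q rewrite oneTo-suc q = mk⇔
  (λ { (x<y ∷ rest) → x<y , All.map⁺ (All.map⁻ (All.map⁻ rest)) })
  (λ { (x<y , rest) → x<y ∷ All.map⁺ (All.map⁺ (All.map⁻ rest)) })

increasingBefore⇒increasingUpTo : ∀ m x xs → IncreasingBefore m (x ∷ xs) → IncreasingUpTo m x xs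
increasingBefore⇒increasingUpTo m x [] _ = []
increasingBefore⇒increasingUpTo m x (y ∷ ys) inc with x ≟ m
... | yes refl = atMax
... | no  _ with Equivalence.to (All-AscentAt-oneTo-suc x y ys (pos m (y ∷ ys) ∸ 1))
                   (subst (λ p → All (AscentAt (x ∷ y ∷ ys)) (oneTo p)) (pos-∷ m y ys) inc)
...   | x<y , rest = x<y ∷ increasingBefore⇒increasingUpTo m y ys rest

increasingUpTo⇒increasingBefore : ∀ m x xs → IncreasingUpTo m x xs → IncreasingBefore m (x ∷ xs)
increasingUpTo⇒increasingBefore m x xs inc with x ≟ m
... | yes _ = []
increasingUpTo⇒increasingBefore m x [] [] | no _ = []
increasingUpTo⇒increasingBefore m x xs atMax | no x≢m = ⊥-elim (x≢m refl)
increasingUpTo⇒increasingBefore m x (y ∷ ys) (x<y ∷ inc) | no _ =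
  subst (λ p → All (AscentAt (x ∷ y ∷ ys)) (oneTo p)) (sym (pos-∷ m y ys))
    (Equivalence.from (All-AscentAt-oneTo-suc x y ys (pos m (y ∷ ys) ∸ 1))
      (x<y , increasingUpTo⇒increasingBefore m y ys inc))

increasingUpTo-++ : ∀ {m x ys} zs → IncreasingUpTo m x ys → m ∈ x ∷ ys → IncreasingUpTo m x (ys ++ zs)
increasingUpTo-++ zs atMax _ = atMax
increasingUpTo-++ zs [] (here refl) = atMax
increasingUpTo-++ zs (x<y ∷ inc) (here refl) = atMax
increasingUpTo-++ zs (x<y ∷ inc) (there m∈ys) = x<y ∷ increasingUpTo-++ zs inc m∈ys

increasingUpTo-map-suc : ∀ {m x s} → IncreasingUpTo m x s → IncreasingUpTo (suc m) (suc x) (map suc s)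
increasingUpTo-map-suc [] = []
increasingUpTo-map-suc atMax = atMax
increasingUpTo-map-suc (x<y ∷ inc) = s≤s x<y ∷ increasingUpTo-map-suc inc


InRange : ℕ → ℕ → Set
InRange m x = 1 ≤ x × x ≤ m

∈-oneTo : ∀ {m v} → InRange m v → v ∈ oneTo m
∈-oneTo {v = suc v} (_ , v<m) = ∈-map⁺ suc (∈-upTo⁺ v<m)

∈-─ : ∀ {A : Set} {x y : A} {ys} → y ∈ ys → (x∈ys : x ∈ ys) → y ≢ x → y ∈ (ys ─ x∈ys)
∈-─ (here refl) (here refl) y≢x = ⊥-elim (y≢x refl)
∈-─ (here y≡z)  (there _)   _   = here y≡z
∈-─ (there y∈)  (here _)    _   = y∈
∈-─ (there y∈)  (there x∈)  y≢x = there (∈-─ y∈ x∈ y≢x)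

unique⇒length≤ : ∀ {A : Set} {xs ys : List A} → Unique xs → All (_∈ ys) xs → length xs ≤ length ys
unique⇒length≤ [] [] = z≤n
unique⇒length≤ {ys = ys} (x∉xs ∷ u) (x∈ys ∷ xs⊆ys) =
  subst (_ ≤_) (sym (length-removeAt′ ys _))
    (s≤s (unique⇒length≤ u
      (All.zipWith (λ (x≢y , y∈ys) → ∈-─ y∈ys x∈ys (≢-sym x≢y)) (x∉xs , xs⊆ys))))

isPerm⇒∈ : ∀ {m w v} → IsPerm m w → InRange m v → v ∈ w
isPerm⇒∈ {m} {w} {v} (length≡m , inRange , unique) v-inRange with v ∈? w
... | yes v∈w = v∈w
... | no  v∉w = ⊥-elim (1+n≰n (subst (_≤ length (oneTo m ─ v∈oneTo)) w≡1+rest w≤rest))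
  where
  v∈oneTo : v ∈ oneTo m
  v∈oneTo = ∈-oneTo v-inRange
  w≤rest : length w ≤ length (oneTo m ─ v∈oneTo)
  w≤rest = unique⇒length≤ unique
    (All.tabulate (λ {x} x∈w → ∈-─ (∈-oneTo (All.lookup inRange x∈w)) v∈oneTo (λ { refl → v∉w x∈w })))
  w≡1+rest : length w ≡ suc (length (oneTo m ─ v∈oneTo))
  w≡1+rest = trans length≡m (trans (sym (length-oneTo m)) (length-removeAt′ (oneTo m) _))

isPerm⇒1∈tail : ∀ {m x xs} → IsPerm (suc m) (x ∷ xs) → x ≢ 1 → 1 ∈ xs
isPerm⇒1∈tail perm x≢1 with isPerm⇒∈ perm (s≤s z≤n , s≤s z≤n)
... | here 1≡x   = ⊥-elim (x≢1 (sym 1≡x))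
... | there 1∈xs = 1∈xs

inRange-map-suc : ∀ {m s} → All (InRange m) s → All (InRange (suc m)) (map suc s)
inRange-map-suc inRange = All.map⁺ (All.map (λ (_ , b≤m) → s≤s z≤n , s≤s b≤m) inRange)


Positive : List ℕ → Set
Positive = All (1 ≤_)

OneFree : List ℕ → Set
OneFree = All (1 ≢_)

map-suc-map-pred : ∀ {r} → Positive r → map suc (map pred r) ≡ r
map-suc-map-pred [] = refl
map-suc-map-pred {suc b ∷ r} (_ ∷ positive) = cong (suc b ∷_) (map-suc-map-pred positive)

map-pred-map-suc : ∀ s → map pred (map suc s) ≡ s
map-pred-map-suc s = trans (sym (map-∘ s)) (map-id s)

positive-map-suc : ∀ s → Positive (map suc s)
positive-map-suc [] = []
positive-map-suc (b ∷ s) = s≤s z≤n ∷ positive-map-suc s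

oneFree-map-suc : ∀ {s} → Positive s → OneFree (map suc s)
oneFree-map-suc [] = []
oneFree-map-suc {suc b ∷ s} (_ ∷ positive) = (λ ()) ∷ oneFree-map-suc positive

pos-map-suc : ∀ m s → pos (suc m) (map suc s) ≡ pos m s
pos-map-suc m [] = refl
pos-map-suc m (b ∷ s) with b ≟ m | suc b ≟ suc m
... | yes _   | yes _     = refl
... | no  _   | no  _     = cong suc (pos-map-suc m s)
... | yes b≡m | no  1+b≢m = ⊥-elim (1+b≢m (cong suc b≡m))
... | no  b≢m | yes 1+b≡m = ⊥-elim (b≢m (suc-injective 1+b≡m))

ascentsFrom-map-pred : ∀ a {r} → Positive r → ascentsFrom a (map pred r) ≡ ascentsFrom (suc a) r
ascentsFrom-map-pred a {r} positive =
  trans (sym (ascentsFrom-map-suc a (map pred r))) (cong (ascentsFrom (suc a)) (map-suc-map-pred positive))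


-- Removing the letter 1

removeOne : List ℕ → List ℕ
removeOne [] = []
removeOne (x ∷ xs) with x ≟ 1
... | yes _ = map pred xs
... | no  _ = pred x ∷ removeOne xs

-- One more than the number of ascents of x ∷ ys before the letter 1: when 1 sits inside an
-- ascent, this is the rank of that ascent once 1 is removed.
ascentIndexFrom : ℕ → List ℕ → ℕ
ascentIndexFrom x [] = 0
ascentIndexFrom x (y ∷ ys) with y ≟ 1
... | yes _ = 1
... | no  _ = sucIf (x <ᵇ y) (ascentIndexFrom y ys)

ascentIndex : List ℕ → ℕ
ascentIndex [] = 0
ascentIndex (x ∷ xs) = ascentIndexFrom x xs

data OneLast : List ℕ → Set where
  [1] : OneLast (1 ∷ [])
  _∷_ : ∀ {y ys} → y ≢ 1 → OneLast ys → OneLast (y ∷ ys)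

data OneInAscent : ℕ → List ℕ → Set where
  inside : ∀ {x z r} → x < z → OneInAscent x (1 ∷ z ∷ r)
  _∷_    : ∀ {x y ys} → y ≢ 1 → OneInAscent y ys → OneInAscent x (y ∷ ys)

AscentAroundOne : ℕ → List ℕ → Set
AscentAroundOne x xs =
  1 ≤ pos 1 xs × pos 1 xs < length xs × ((x ∷ xs) ! pos 1 xs) < ((x ∷ xs) ! suc (suc (pos 1 xs)))

removeOne-∷ : ∀ {x} xs → x ≢ 1 → removeOne (x ∷ xs) ≡ pred x ∷ removeOne xs
removeOne-∷ {x} xs x≢1 with x ≟ 1
... | yes x≡1 = ⊥-elim (x≢1 x≡1)
... | no  _   = refl

ascentIndexFrom-∷ : ∀ x {y} ys → y ≢ 1 → ascentIndexFrom x (y ∷ ys) ≡ sucIf (x <ᵇ y) (ascentIndexFrom y ys)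
ascentIndexFrom-∷ x {y} ys y≢1 with y ≟ 1
... | yes y≡1 = ⊥-elim (y≢1 y≡1)
... | no  _   = refl

All-removeOne : ∀ {Q : ℕ → Set} w → Unique w → All (λ y → y ≢ 1 → Q (pred y)) w → All Q (removeOne w)
All-removeOne [] _ _ = []
All-removeOne (x ∷ xs) (x∉xs ∷ u) (qx ∷ qs) with x ≟ 1
... | yes refl = All.map⁺ (All.zipWith (λ (q , 1≢y) → q (≢-sym 1≢y)) (qs , x∉xs))
... | no  x≢1  = qx x≢1 ∷ All-removeOne xs u qs

pred-≢-All : ∀ {x ys} → 1 ≤ x → All (x ≢_) ys → Positive ys → All (λ y → pred x ≢ pred y) ys
pred-≢-All 1≤x x∉ys positive = All.zipWith (λ (x≢y , 1≤y) → pred-≢ 1≤x 1≤y x≢y) (x∉ys , positive)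

unique-map-pred : ∀ {xs} → Unique xs → Positive xs → Unique (map pred xs)
unique-map-pred [] [] = []
unique-map-pred (x∉xs ∷ u) (1≤x ∷ positive) = All.map⁺ (pred-≢-All 1≤x x∉xs positive) ∷ unique-map-pred u positive

unique-removeOne : ∀ w → Unique w → Positive w → Unique (removeOne w)
unique-removeOne [] _ _ = []
unique-removeOne (x ∷ xs) (x∉xs ∷ u) (1≤x ∷ positive) with x ≟ 1
... | yes _ = unique-map-pred u positive
... | no  _ =
  All-removeOne xs u (All.map (λ x≢y _ → x≢y) (pred-≢-All 1≤x x∉xs positive)) ∷ unique-removeOne xs u positive

inRange-removeOne : ∀ m w → Unique w → All (InRange (suc m)) w → All (InRange m) (removeOne w)
inRange-removeOne m w u inRange = All-removeOne w u (All.map inRange-pred inRange)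
  where
  inRange-pred : ∀ {y} → InRange (suc m) y → y ≢ 1 → InRange m (pred y)
  inRange-pred {suc zero}    _             y≢1 = ⊥-elim (y≢1 refl)
  inRange-pred {suc (suc y)} (_ , s≤s y≤m) _   = s≤s z≤n , y≤m

length-removeOne : ∀ w → 1 ∈ w → suc (length (removeOne w)) ≡ length w
length-removeOne (x ∷ xs) 1∈w with x ≟ 1
... | yes _ = cong suc (length-map pred xs)
length-removeOne (x ∷ xs) (here 1≡x)  | no x≢1 = ⊥-elim (x≢1 (sym 1≡x))
length-removeOne (x ∷ xs) (there 1∈xs) | no _  = cong suc (length-removeOne xs 1∈xs)

increasingUpTo-removeOne : ∀ {m x xs} → IncreasingUpTo m x xs → 1 ≤ x → Positive xs →
                           IncreasingUpTo (pred m) (pred x) (removeOne xs)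
increasingUpTo-removeOne [] _ _ = []
increasingUpTo-removeOne atMax _ _ = atMax
increasingUpTo-removeOne {xs = y ∷ ys} (x<y ∷ inc) 1≤x (1≤y ∷ positive)
  rewrite removeOne-∷ ys (λ y≡1 → <-irrefl (sym y≡1) (≤-<-trans 1≤x x<y)) =
  ∸-monoˡ-< x<y 1≤x ∷ increasingUpTo-removeOne inc 1≤y positive

ascentsFrom-removeOne-last : ∀ {x xs} → 1 ≤ x → Positive xs → OneLast xs →
                             ascentsFrom (pred x) (removeOne xs) ≡ ascentsFrom x xs
ascentsFrom-removeOne-last {x} 1≤x _ [1] rewrite <ᵇ-false {x} {1} (≤⇒≯ 1≤x) = refl
ascentsFrom-removeOne-last {suc a} {suc b ∷ ys} _ (1≤y ∷ positive) (y≢1 ∷ last)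
  rewrite removeOne-∷ ys y≢1 = cong (sucIf (a <ᵇ b)) (ascentsFrom-removeOne-last 1≤y positive last)

ascentsFrom-removeOne-inside : ∀ {x xs} → 1 ≤ x → Positive xs → OneInAscent x xs →
                               ascentsFrom (pred x) (removeOne xs) ≡ ascentsFrom x xs
ascentsFrom-removeOne-inside {suc a} _ (_ ∷ _ ∷ positive) (inside {z = suc (suc c)} (s≤s a<1+c))
  rewrite <ᵇ-true a<1+c = cong suc (ascentsFrom-map-pred (suc c) positive)
ascentsFrom-removeOne-inside {suc a} _ _ (inside {z = suc zero} (s≤s ()))
ascentsFrom-removeOne-inside {suc a} {suc b ∷ ys} _ (1≤y ∷ positive) (y≢1 ∷ inAsc)
  rewrite removeOne-∷ ys y≢1 = cong (sucIf (a <ᵇ b)) (ascentsFrom-removeOne-inside 1≤y positive inAsc)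

1≤ascentIndexFrom : ∀ {x xs} → OneInAscent x xs → 1 ≤ ascentIndexFrom x xs
1≤ascentIndexFrom (inside _) = s≤s z≤n
1≤ascentIndexFrom {x} {y ∷ ys} (y≢1 ∷ inAsc) rewrite ascentIndexFrom-∷ x ys y≢1 =
  sucIf-positive (x <ᵇ y) (1≤ascentIndexFrom inAsc)

ascentIndexFrom≤ascentsFrom : ∀ {x xs} → OneInAscent x xs → ascentIndexFrom x xs ≤ ascentsFrom x xs
ascentIndexFrom≤ascentsFrom {x} (inside {z = z} x<z) with x <ᵇ 1 | <ᵇ-reflects-< x 1
... | true  | _       = s≤s z≤n
... | false | ofⁿ x≮1 rewrite <ᵇ-true (≤-<-trans (≮⇒≥ x≮1) x<z) = s≤s z≤n
ascentIndexFrom≤ascentsFrom {x} {y ∷ ys} (y≢1 ∷ inAsc) rewrite ascentIndexFrom-∷ x ys y≢1 =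
  sucIf-mono-≤ (x <ᵇ y) (ascentIndexFrom≤ascentsFrom inAsc)

pos-removeOne≤ascentIndexFrom : ∀ {m x xs} → IncreasingUpTo m x xs → OneInAscent x xs →
                                1 ≤ x → Positive xs →
                                pos (pred m) (pred x ∷ removeOne xs) ≤ ascentIndexFrom x xs
pos-removeOne≤ascentIndexFrom {m} atMax inAsc _ _ with pred m ≟ pred m
... | yes _   = 1≤ascentIndexFrom inAsc
... | no  m≢m = ⊥-elim (m≢m refl)
pos-removeOne≤ascentIndexFrom (x<1 ∷ _) (inside _) 1≤x _ = ⊥-elim (<⇒≱ x<1 1≤x)
pos-removeOne≤ascentIndexFrom {m} {x} {y ∷ ys} (x<y ∷ inc) (y≢1 ∷ inAsc) 1≤x (1≤y ∷ positive)
  rewrite removeOne-∷ ys y≢1 with pred x ≟ pred m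
... | yes _ = 1≤ascentIndexFrom (y≢1 ∷ inAsc)
... | no  _ rewrite ascentIndexFrom-∷ x ys y≢1 | <ᵇ-true x<y =
  s≤s (pos-removeOne≤ascentIndexFrom inc inAsc 1≤y positive)

pos≡length⇒oneLast : ∀ {xs} → 1 ∈ xs → pos 1 xs ≡ length xs → OneLast xs
pos≡length⇒oneLast {y ∷ ys} _ _ with y ≟ 1
pos≡length⇒oneLast {.1 ∷ []}    _ _  | yes refl = [1]
pos≡length⇒oneLast {.1 ∷ _ ∷ _} _ () | yes refl
pos≡length⇒oneLast (here 1≡y)   _         | no y≢1 = ⊥-elim (y≢1 (sym 1≡y))
pos≡length⇒oneLast (there 1∈ys) pos≡length | no y≢1 =
  y≢1 ∷ pos≡length⇒oneLast 1∈ys (suc-injective pos≡length)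

oneInAscent⇒ascentAroundOne : ∀ {x xs} → OneInAscent x xs → AscentAroundOne x xs
oneInAscent⇒ascentAroundOne (inside x<z) = s≤s z≤n , s≤s (s≤s z≤n) , x<z
oneInAscent⇒ascentAroundOne {x} {y ∷ ys} (y≢1 ∷ inAsc) rewrite pos-∷-≢ ys y≢1
  with oneInAscent⇒ascentAroundOne inAsc
... | 1≤p , p<len , valley =
  s≤s z≤n , s≤s p<len ,
  subst (_< ((y ∷ ys) ! suc (suc (pos 1 ys)))) (sym (!-∷ x (y ∷ ys) (pos 1 ys) 1≤p)) valley

ascentAroundOne⇒oneInAscent : ∀ {x xs} → AscentAroundOne x xs → OneInAscent x xs
ascentAroundOne⇒oneInAscent {x} {y ∷ ys} valley with y ≟ 1
ascentAroundOne⇒oneInAscent {x} {.1 ∷ z ∷ r} (_ , _ , x<z)  | yes refl = inside x<z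
ascentAroundOne⇒oneInAscent {x} {.1 ∷ []}    (_ , s≤s () , _) | yes refl
ascentAroundOne⇒oneInAscent {x} {y ∷ []}     (_ , s≤s () , _) | no _
ascentAroundOne⇒oneInAscent {x} {y ∷ z ∷ zs} (_ , s≤s p<len , valley) | no y≢1 =
  y≢1 ∷ ascentAroundOne⇒oneInAscent (1≤p , p<len , subst (_< ((y ∷ z ∷ zs) ! suc (suc (pos 1 (z ∷ zs)))))
                                                     (!-∷ x (y ∷ z ∷ zs) (pos 1 (z ∷ zs)) 1≤p) valley)
  where 1≤p = 1≤pos-∷ 1 z zs


-- Inserting the letter 1

-- Inserts the letter 1 into the i-th ascent of x ∷ ys (nothing happens for i = 0).
insertOneFrom : ℕ → ℕ → List ℕ → List ℕ
insertOneFrom zero x ys = ys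
insertOneFrom (suc i) x [] = []
insertOneFrom (suc zero) x (y ∷ ys) with x <ᵇ y
... | true  = 1 ∷ y ∷ ys
... | false = y ∷ insertOneFrom 1 y ys
insertOneFrom (suc (suc i)) x (y ∷ ys) with x <ᵇ y
... | true  = y ∷ insertOneFrom (suc i) y ys
... | false = y ∷ insertOneFrom (suc (suc i)) y ys

insertOne : ℕ → List ℕ → List ℕ
insertOne i [] = []
insertOne i (x ∷ xs) = x ∷ insertOneFrom i x xs

insertOneFrom-∷ : ∀ i x y ys → 1 ≤ i →
                  insertOneFrom (sucIf (x <ᵇ y) i) x (y ∷ ys) ≡ y ∷ insertOneFrom i y ys
insertOneFrom-∷ (suc i) x y ys _ with x <ᵇ y in x<ᵇy
insertOneFrom-∷ (suc i)       x y ys _ | true  rewrite x<ᵇy = refl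
insertOneFrom-∷ (suc zero)    x y ys _ | false rewrite x<ᵇy = refl
insertOneFrom-∷ (suc (suc i)) x y ys _ | false rewrite x<ᵇy = refl

length-insertOneFrom : ∀ i x ys → 1 ≤ i → i ≤ ascentsFrom x ys →
                       length (insertOneFrom i x ys) ≡ suc (length ys)
length-insertOneFrom (suc zero) x (y ∷ ys) _ i≤asc with x <ᵇ y
... | true  = refl
... | false = cong suc (length-insertOneFrom 1 y ys (s≤s z≤n) i≤asc)
length-insertOneFrom (suc (suc i)) x (y ∷ ys) 1≤i i≤asc with x <ᵇ y
... | true  = cong suc (length-insertOneFrom (suc i) y ys (s≤s z≤n) (≤-pred i≤asc))
... | false = cong suc (length-insertOneFrom (suc (suc i)) y ys 1≤i i≤asc)

All-insertOneFrom : ∀ {P : ℕ → Set} i x ys → P 1 → All P ys → All P (insertOneFrom i x ys)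
All-insertOneFrom zero x ys _ ps = ps
All-insertOneFrom (suc i) x [] _ ps = ps
All-insertOneFrom (suc zero) x (y ∷ ys) p1 (py ∷ ps) with x <ᵇ y
... | true  = p1 ∷ py ∷ ps
... | false = py ∷ All-insertOneFrom 1 y ys p1 ps
All-insertOneFrom (suc (suc i)) x (y ∷ ys) p1 (py ∷ ps) with x <ᵇ y
... | true  = py ∷ All-insertOneFrom (suc i) y ys p1 ps
... | false = py ∷ All-insertOneFrom (suc (suc i)) y ys p1 ps

unique-insertOneFrom : ∀ i x ys → Unique ys → OneFree ys → Unique (insertOneFrom i x ys)
unique-insertOneFrom zero x ys u _ = u
unique-insertOneFrom (suc i) x [] u _ = u
unique-insertOneFrom (suc zero) x (y ∷ ys) (y∉ys ∷ u) (1≢y ∷ oneFree) with x <ᵇ y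
... | true  = (1≢y ∷ oneFree) ∷ y∉ys ∷ u
... | false = All-insertOneFrom 1 y ys (≢-sym 1≢y) y∉ys ∷ unique-insertOneFrom 1 y ys u oneFree
unique-insertOneFrom (suc (suc i)) x (y ∷ ys) (y∉ys ∷ u) (1≢y ∷ oneFree) with x <ᵇ y
... | true  = All-insertOneFrom (suc i) y ys (≢-sym 1≢y) y∉ys ∷ unique-insertOneFrom (suc i) y ys u oneFree
... | false =
  All-insertOneFrom (suc (suc i)) y ys (≢-sym 1≢y) y∉ys ∷ unique-insertOneFrom (suc (suc i)) y ys u oneFree

removeOne-oneFree : ∀ {ys} → OneFree ys → removeOne ys ≡ map pred ys
removeOne-oneFree [] = refl
removeOne-oneFree {y ∷ ys} (1≢y ∷ oneFree) rewrite removeOne-∷ ys (≢-sym 1≢y) =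
  cong (pred y ∷_) (removeOne-oneFree oneFree)

removeOne-insertOneFrom : ∀ i x ys → OneFree ys → removeOne (insertOneFrom i x ys) ≡ map pred ys
removeOne-insertOneFrom zero x ys oneFree = removeOne-oneFree oneFree
removeOne-insertOneFrom (suc i) x [] _ = refl
removeOne-insertOneFrom (suc zero) x (y ∷ ys) (1≢y ∷ oneFree) with x <ᵇ y
... | true  = refl
... | false rewrite removeOne-∷ (insertOneFrom 1 y ys) (≢-sym 1≢y) =
  cong (pred y ∷_) (removeOne-insertOneFrom 1 y ys oneFree)
removeOne-insertOneFrom (suc (suc i)) x (y ∷ ys) (1≢y ∷ oneFree) with x <ᵇ y
... | true  rewrite removeOne-∷ (insertOneFrom (suc i) y ys) (≢-sym 1≢y) =
  cong (pred y ∷_) (removeOne-insertOneFrom (suc i) y ys oneFree)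
... | false rewrite removeOne-∷ (insertOneFrom (suc (suc i)) y ys) (≢-sym 1≢y) =
  cong (pred y ∷_) (removeOne-insertOneFrom (suc (suc i)) y ys oneFree)

ascentIndexFrom-insertOneFrom : ∀ i x ys → OneFree ys → 1 ≤ i → i ≤ ascentsFrom x ys →
                                ascentIndexFrom x (insertOneFrom i x ys) ≡ i
ascentIndexFrom-insertOneFrom (suc zero) x (y ∷ ys) (1≢y ∷ oneFree) 1≤i i≤asc with x <ᵇ y in x<ᵇy
... | true  = refl
... | false rewrite ascentIndexFrom-∷ x (insertOneFrom 1 y ys) (≢-sym 1≢y) | x<ᵇy =
  ascentIndexFrom-insertOneFrom 1 y ys oneFree 1≤i i≤asc
ascentIndexFrom-insertOneFrom (suc (suc i)) x (y ∷ ys) (1≢y ∷ oneFree) 1≤i i≤asc with x <ᵇ y in x<ᵇy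
... | true  rewrite ascentIndexFrom-∷ x (insertOneFrom (suc i) y ys) (≢-sym 1≢y) | x<ᵇy =
  cong suc (ascentIndexFrom-insertOneFrom (suc i) y ys oneFree (s≤s z≤n) (≤-pred i≤asc))
... | false rewrite ascentIndexFrom-∷ x (insertOneFrom (suc (suc i)) y ys) (≢-sym 1≢y) | x<ᵇy =
  ascentIndexFrom-insertOneFrom (suc (suc i)) y ys oneFree 1≤i i≤asc

ascentsFrom-insertOneFrom : ∀ i x ys → Positive ys → OneFree ys → 1 ≤ x → 1 ≤ i → i ≤ ascentsFrom x ys →
                            ascentsFrom x (insertOneFrom i x ys) ≡ ascentsFrom x ys
ascentsFrom-insertOneFrom (suc zero) x (y ∷ ys) (1≤y ∷ positive) (1≢y ∷ oneFree) 1≤x 1≤i i≤asc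
  with x <ᵇ y in x<ᵇy
... | true  rewrite <ᵇ-false {x} {1} (≤⇒≯ 1≤x) | <ᵇ-true (≤∧≢⇒< 1≤y 1≢y) = refl
... | false rewrite x<ᵇy = ascentsFrom-insertOneFrom 1 y ys positive oneFree 1≤y 1≤i i≤asc
ascentsFrom-insertOneFrom (suc (suc i)) x (y ∷ ys) (1≤y ∷ positive) (1≢y ∷ oneFree) 1≤x 1≤i i≤asc
  with x <ᵇ y in x<ᵇy
... | true  rewrite x<ᵇy =
  cong suc (ascentsFrom-insertOneFrom (suc i) y ys positive oneFree 1≤y (s≤s z≤n) (≤-pred i≤asc))
... | false rewrite x<ᵇy = ascentsFrom-insertOneFrom (suc (suc i)) y ys positive oneFree 1≤y 1≤i i≤asc

oneInAscent-insertOneFrom : ∀ i x ys → OneFree ys → 1 ≤ i → i ≤ ascentsFrom x ys →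
                            OneInAscent x (insertOneFrom i x ys)
oneInAscent-insertOneFrom (suc zero) x (y ∷ ys) (1≢y ∷ oneFree) 1≤i i≤asc with x <ᵇ y | <ᵇ-reflects-< x y
... | true  | ofʸ x<y = inside x<y
... | false | _       = ≢-sym 1≢y ∷ oneInAscent-insertOneFrom 1 y ys oneFree 1≤i i≤asc
oneInAscent-insertOneFrom (suc (suc i)) x (y ∷ ys) (1≢y ∷ oneFree) 1≤i i≤asc with x <ᵇ y
... | true  = ≢-sym 1≢y ∷ oneInAscent-insertOneFrom (suc i) y ys oneFree (s≤s z≤n) (≤-pred i≤asc)
... | false = ≢-sym 1≢y ∷ oneInAscent-insertOneFrom (suc (suc i)) y ys oneFree 1≤i i≤asc

increasingUpTo-insertOneFrom : ∀ m i x ys → IncreasingUpTo m x ys → pos m (x ∷ ys) ≤ i →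
                               IncreasingUpTo m x (insertOneFrom i x ys)
increasingUpTo-insertOneFrom m zero x ys inc _ = inc
increasingUpTo-insertOneFrom m (suc i) x [] inc _ = inc
increasingUpTo-insertOneFrom m (suc i) x (y ∷ ys) atMax _ = atMax
increasingUpTo-insertOneFrom m (suc zero) x (y ∷ ys) (x<y ∷ inc) pos≤i with x ≟ m
... | yes refl = atMax
... | no  _    = ⊥-elim (1+n≰n (≤-trans (s≤s (1≤pos-∷ m y ys)) pos≤i))
increasingUpTo-insertOneFrom m (suc (suc i)) x (y ∷ ys) (x<y ∷ inc) pos≤i with x ≟ m
... | yes refl = atMax
... | no  _ rewrite <ᵇ-true x<y = x<y ∷ increasingUpTo-insertOneFrom m (suc i) y ys inc (≤-pred pos≤i)

insertOneFrom-removeOne : ∀ {x xs} → Positive xs → OneInAscent x xs →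
                          insertOneFrom (ascentIndexFrom x xs) x (map suc (removeOne xs)) ≡ xs
insertOneFrom-removeOne (_ ∷ _ ∷ positive) (inside {z = suc c} x<z)
  rewrite <ᵇ-true x<z | map-suc-map-pred positive = refl
insertOneFrom-removeOne {x} {suc b ∷ ys} (_ ∷ positive) (y≢1 ∷ inAsc)
  rewrite removeOne-∷ ys y≢1 | ascentIndexFrom-∷ x ys y≢1 =
  trans (insertOneFrom-∷ (ascentIndexFrom (suc b) ys) x (suc b) (map suc (removeOne ys))
                         (1≤ascentIndexFrom inAsc))
        (cong (suc b ∷_) (insertOneFrom-removeOne positive inAsc))

insertOne-removeOne : ∀ {x xs} → Positive (x ∷ xs) → x ≢ 1 → OneInAscent x xs →
                      insertOne (ascentIndex (x ∷ xs)) (map suc (removeOne (x ∷ xs))) ≡ x ∷ xs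
insertOne-removeOne {suc a} {xs} (_ ∷ positive) x≢1 inAsc rewrite removeOne-∷ xs x≢1 =
  cong (suc a ∷_) (insertOneFrom-removeOne positive inAsc)

removeOne-++-[1] : ∀ {ys} → OneFree ys → removeOne (ys ++ 1 ∷ []) ≡ map pred ys
removeOne-++-[1] [] = refl
removeOne-++-[1] {y ∷ ys} (1≢y ∷ oneFree) rewrite removeOne-∷ (ys ++ 1 ∷ []) (≢-sym 1≢y) =
  cong (pred y ∷_) (removeOne-++-[1] oneFree)

pos-++-[1] : ∀ {ys} → OneFree ys → pos 1 (ys ++ 1 ∷ []) ≡ suc (length ys)
pos-++-[1] [] = refl
pos-++-[1] {y ∷ ys} (1≢y ∷ oneFree) rewrite pos-∷-≢ (ys ++ 1 ∷ []) (≢-sym 1≢y) =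
  cong suc (pos-++-[1] oneFree)

ascentsFrom-++-[1] : ∀ {x ys} → 1 ≤ x → Positive ys → ascentsFrom x (ys ++ 1 ∷ []) ≡ ascentsFrom x ys
ascentsFrom-++-[1] {x} 1≤x [] rewrite <ᵇ-false {x} {1} (≤⇒≯ 1≤x) = refl
ascentsFrom-++-[1] {x} {y ∷ ys} _ (1≤y ∷ positive) = cong (sucIf (x <ᵇ y)) (ascentsFrom-++-[1] 1≤y positive)

unique-++-[1] : ∀ {ys} → Unique ys → OneFree ys → Unique (ys ++ 1 ∷ [])
unique-++-[1] [] [] = [] ∷ []
unique-++-[1] (y∉ys ∷ u) (1≢y ∷ oneFree) = All.++⁺ y∉ys (≢-sym 1≢y ∷ []) ∷ unique-++-[1] u oneFree

append1-removeOne : ∀ {xs} → Positive xs → OneLast xs → map suc (removeOne xs) ++ 1 ∷ [] ≡ xs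
append1-removeOne _ [1] = refl
append1-removeOne {suc b ∷ ys} (_ ∷ positive) (y≢1 ∷ last) rewrite removeOne-∷ ys y≢1 =
  cong (suc b ∷_) (append1-removeOne positive last)


inQ-removeOne : ∀ {m x xs} → x ≢ 1 → InQ (suc m) (x ∷ xs) → InQ m (removeOne (x ∷ xs))
inQ-removeOne {m} {x} {xs} x≢1 (perm@(length≡ , inRange , unique) , increasing) =
  ( suc-injective (trans (length-removeOne (x ∷ xs) (there 1∈xs)) length≡)
  , inRange-removeOne m (x ∷ xs) unique inRange
  , unique-removeOne (x ∷ xs) unique positive )
  , subst (IncreasingBefore m) (sym (removeOne-∷ xs x≢1))
      (increasingUpTo⇒increasingBefore m (pred x) (removeOne xs)
        (increasingUpTo-removeOne (increasingBefore⇒increasingUpTo (suc m) x xs increasing)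
          (All.head positive) (All.tail positive)))
  where
  positive : Positive (x ∷ xs)
  positive = All.map proj₁ inRange
  1∈xs : 1 ∈ xs
  1∈xs = isPerm⇒1∈tail perm x≢1

inQ-append1 : ∀ {m a s'} → InQ m (a ∷ s') → InQ (suc m) (map suc (a ∷ s') ++ 1 ∷ [])
inQ-append1 {m} {a} {s'} (perm@(length≡ , inRange , unique) , increasing) =
  ( trans (length-++ (map suc (a ∷ s'))) (trans (+-comm _ 1) (cong suc (trans (length-map suc (a ∷ s')) length≡)))
  , All.++⁺ (inRange-map-suc inRange) ((s≤s z≤n , s≤s z≤n) ∷ [])
  , unique-++-[1] (Unique.map⁺ suc-injective unique) (oneFree-map-suc (All.map proj₁ inRange)) )
  , increasingUpTo⇒increasingBefore (suc m) (suc a) (map suc s' ++ 1 ∷ [])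
      (increasingUpTo-++ (1 ∷ []) (increasingUpTo-map-suc (increasingBefore⇒increasingUpTo m a s' increasing))
        (∈-map⁺ suc (isPerm⇒∈ perm (subst (1 ≤_) length≡ (s≤s z≤n) , ≤-refl))))

inQ-insertOne : ∀ {m a s' i} → InQ m (a ∷ s') → 1 ≤ i → i ≤ ascentsFrom a s' → pos m (a ∷ s') ≤ i →
                InQ (suc m) (suc a ∷ insertOneFrom i (suc a) (map suc s'))
inQ-insertOne {m} {a} {s'} {i} ((length≡ , inRange , unique) , increasing) 1≤i i≤asc pos≤i
  with inRange-map-suc inRange | Unique.map⁺ suc-injective unique
... | a∈[m] ∷ s∈[m] | a∉s ∷ unique-s =
  ( cong suc (trans (length-insertOneFrom i (suc a) (map suc s') 1≤i i≤asc′)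
                    (trans (cong suc (length-map suc s')) length≡))
  , a∈[m] ∷ All-insertOneFrom i (suc a) (map suc s') (s≤s z≤n , s≤s z≤n) s∈[m]
  , All-insertOneFrom i (suc a) (map suc s') (>⇒≢ (s≤s 1≤a)) a∉s
    ∷ unique-insertOneFrom i (suc a) (map suc s') unique-s (oneFree-map-suc (All.tail positive)) )
  , increasingUpTo⇒increasingBefore (suc m) (suc a) (insertOneFrom i (suc a) (map suc s'))
      (increasingUpTo-insertOneFrom (suc m) i (suc a) (map suc s')
        (increasingUpTo-map-suc (increasingBefore⇒increasingUpTo m a s' increasing))
        (subst (_≤ i) (sym (pos-map-suc m (a ∷ s'))) pos≤i))
  where
  positive : Positive (a ∷ s')
  positive = All.map proj₁ inRange
  1≤a : 1 ≤ a
  1≤a = All.head positive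
  i≤asc′ : i ≤ ascentsFrom (suc a) (map suc s')
  i≤asc′ = subst (i ≤_) (sym (ascentsFrom-map-suc a s')) i≤asc


-- The bijection

RAbar→RFA : ℕ → List ℕ → List ℕ × ℕ
RAbar→RFA n w with pos 1 w ≟ n + 2
... | yes _ = removeOne w , n + 1
... | no  _ = removeOne w , ascentIndex w

RFA→RAbar : ℕ → List ℕ × ℕ → List ℕ
RFA→RAbar n (σ , i) with i ≟ n + 1
... | yes _ = map suc σ ++ 1 ∷ []
... | no  _ = insertOne i (map suc σ)

InteriorOne : ℕ → List ℕ → Set
InteriorOne n w = 2 ≤ pos 1 w × pos 1 w ≤ n + 1 × (w ! (pos 1 w ∸ 1)) < (w ! suc (pos 1 w))

OnePosition : ℕ → List ℕ → Set
OnePosition n w = pos 1 w ≡ n + 2 ⊎ InteriorOne n w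

data OneShape (n x : ℕ) (xs : List ℕ) : Set where
  atEnd    : pos 1 (x ∷ xs) ≡ n + 2 → OneLast xs → OneShape n x xs
  inAscent : pos 1 (x ∷ xs) ≢ n + 2 → OneInAscent x xs → OneShape n x xs

≤n+1⇒≢n+2 : ∀ {n p} → p ≤ n + 1 → p ≢ n + 2
≤n+1⇒≢n+2 {n} p≤n+1 refl = 1+n≰n (subst (_≤ n + 1) (+-suc n 1) p≤n+1)

onePosition-head≢1 : ∀ {n x xs} → OnePosition n (x ∷ xs) → x ≢ 1
onePosition-head≢1 {n} (inj₁ pos≡n+2) refl = ≤n+1⇒≢n+2 (m≤n+m 1 n) pos≡n+2
onePosition-head≢1 (inj₂ (s≤s () , _)) refl

oneShape : ∀ {n x xs} → x ≢ 1 → length xs ≡ n + 1 → 1 ∈ xs → OnePosition n (x ∷ xs) → OneShape n x xs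
oneShape {n} {x} {xs} x≢1 length≡ 1∈xs (inj₁ pos≡n+2) =
  atEnd pos≡n+2 (pos≡length⇒oneLast 1∈xs (suc-injective (begin
    suc (pos 1 xs)   ≡⟨ sym (pos-∷-≢ xs x≢1) ⟩
    pos 1 (x ∷ xs)   ≡⟨ pos≡n+2 ⟩
    n + 2            ≡⟨ +-suc n 1 ⟩
    suc (n + 1)      ≡⟨ cong suc (sym length≡) ⟩
    suc (length xs)  ∎)))
  where open ≡-Reasoning
oneShape {n} {x} {xs} x≢1 length≡ 1∈xs (inj₂ valley) rewrite pos-∷-≢ xs x≢1 with valley
... | s≤s 1≤p , p<n+1 , x<z =
  inAscent (≤n+1⇒≢n+2 p<n+1 ∘ trans (sym (pos-∷-≢ xs x≢1)))
           (ascentAroundOne⇒oneInAscent (1≤p , subst (pos 1 xs <_) (sym length≡) p<n+1 , x<z))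

oneInAscent⇒interiorOne : ∀ {n x xs} → x ≢ 1 → length xs ≡ n + 1 → OneInAscent x xs →
                          InteriorOne n (x ∷ xs)
oneInAscent⇒interiorOne {n} {x} {xs} x≢1 length≡ inAsc rewrite pos-∷-≢ xs x≢1
  with oneInAscent⇒ascentAroundOne inAsc
... | 1≤p , p<length , x<z = s≤s 1≤p , subst (pos 1 xs <_) length≡ p<length , x<z

record RAbarWord (n k x : ℕ) (xs : List ℕ) : Set where
  field
    inQ        : InQ (suc (n + 1)) (x ∷ xs)
    x≢1        : x ≢ 1
    positive   : Positive (x ∷ xs)
    length-xs  : length xs ≡ n + 1
    increasing : IncreasingUpTo (suc (n + 1)) x xs
    ascents≡k  : ascentsFrom x xs ≡ k
    shape      : OneShape n x xs

rAbarWord : ∀ {n k x xs} → RAbar n k (x ∷ xs) → RAbarWord n k x xs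
rAbarWord {n} {k} {x} {xs} (inQ+2 , asc≡k , onePos) = record
  { inQ        = inQ
  ; x≢1        = x≢1
  ; positive   = All.map proj₁ inRange
  ; length-xs  = suc-injective length≡
  ; increasing = increasingBefore⇒increasingUpTo (suc (n + 1)) x xs (proj₂ inQ)
  ; ascents≡k  = trans (sym (asc≡ascents (x ∷ xs) (proj₁ (proj₁ inQ+2)))) asc≡k
  ; shape      = oneShape x≢1 (suc-injective length≡) (isPerm⇒1∈tail (proj₁ inQ) x≢1) onePos
  }
  where
  inQ : InQ (suc (n + 1)) (x ∷ xs)
  inQ = subst (λ m → InQ m (x ∷ xs)) (+-suc n 1) inQ+2
  length≡ : length (x ∷ xs) ≡ suc (n + 1)
  length≡ = proj₁ (proj₁ inQ)
  inRange : All (InRange (suc (n + 1))) (x ∷ xs)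
  inRange = proj₁ (proj₂ (proj₁ inQ))
  x≢1 : x ≢ 1
  x≢1 = onePosition-head≢1 onePos

module RAbarWordProperties {n k x xs} (word : RAbarWord n k x xs) where
  open RAbarWord word

  ascentsFrom-removeOne : ascentsFrom (pred x) (removeOne xs) ≡ ascentsFrom x xs
  ascentsFrom-removeOne with shape
  ... | atEnd    _ last  = ascentsFrom-removeOne-last (All.head positive) (All.tail positive) last
  ... | inAscent _ inAsc = ascentsFrom-removeOne-inside (All.head positive) (All.tail positive) inAsc

  σ-inQ : InQ (n + 1) (removeOne (x ∷ xs))
  σ-inQ = inQ-removeOne x≢1 inQ

  σ-asc : asc (n + 1) (removeOne (x ∷ xs)) ≡ k
  σ-asc = begin
    asc (n + 1) (removeOne (x ∷ xs))       ≡⟨ asc≡ascents (removeOne (x ∷ xs)) (proj₁ (proj₁ σ-inQ)) ⟩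
    ascents (removeOne (x ∷ xs))           ≡⟨ cong ascents (removeOne-∷ xs x≢1) ⟩
    ascentsFrom (pred x) (removeOne xs)    ≡⟨ ascentsFrom-removeOne ⟩
    ascentsFrom x xs                       ≡⟨ ascents≡k ⟩
    k                                      ∎
    where open ≡-Reasoning

  ascentIndex<n+1 : OneInAscent x xs → ascentIndexFrom x xs < n + 1
  ascentIndex<n+1 inAsc = begin-strict
    ascentIndexFrom x xs                 ≤⟨ ascentIndexFrom≤ascentsFrom inAsc ⟩
    ascentsFrom x xs                     ≡⟨ sym ascentsFrom-removeOne ⟩
    ascentsFrom (pred x) (removeOne xs)  ≤⟨ ascentsFrom≤length (pred x) (removeOne xs) ⟩
    length (removeOne xs)                <⟨ n<1+n _ ⟩
    suc (length (removeOne xs))          ≡⟨ length-removeOne xs (isPerm⇒1∈tail (proj₁ inQ) x≢1) ⟩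
    length xs                            ≡⟨ length-xs ⟩
    n + 1                                ∎
    where open ≤-Reasoning

  sound : RFA n k (RAbar→RFA n (x ∷ xs))
  sound with pos 1 (x ∷ xs) ≟ n + 2 | shape
  ... | yes p≡ | inAscent p≢ _ = ⊥-elim (p≢ p≡)
  ... | no  p≢ | atEnd p≡ _    = ⊥-elim (p≢ p≡)
  ... | yes _  | atEnd _ _     =
    σ-inQ , σ-asc , inj₂ refl ,
    ≤⇒∸1< (m≤n+m 1 n) (subst (pos (n + 1) (removeOne (x ∷ xs)) ≤_) (proj₁ (proj₁ σ-inQ))
                              (pos≤length (n + 1) (removeOne (x ∷ xs))))
  ... | no  _  | inAscent _ inAsc =
    σ-inQ , σ-asc ,
    inj₁ (1≤ascentIndexFrom inAsc , subst (_ ≤_) ascents≡k (ascentIndexFrom≤ascentsFrom inAsc)) ,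
    ≤⇒∸1< (1≤ascentIndexFrom inAsc)
      (subst (λ σ → pos (n + 1) σ ≤ ascentIndexFrom x xs) (sym (removeOne-∷ xs x≢1))
        (pos-removeOne≤ascentIndexFrom increasing inAsc (All.head positive) (All.tail positive)))

  inverse : RFA→RAbar n (RAbar→RFA n (x ∷ xs)) ≡ x ∷ xs
  inverse with pos 1 (x ∷ xs) ≟ n + 2 | shape
  ... | yes p≡ | inAscent p≢ _ = ⊥-elim (p≢ p≡)
  ... | no  p≢ | atEnd p≡ _    = ⊥-elim (p≢ p≡)
  ... | yes _  | atEnd _ last with n + 1 ≟ n + 1
  ...   | yes _     = append1-removeOne positive (x≢1 ∷ last)
  ...   | no  n+1≢  = ⊥-elim (n+1≢ refl)
  inverse | no _ | inAscent _ inAsc with ascentIndexFrom x xs ≟ n + 1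
  ...   | yes i≡n+1 = ⊥-elim (<-irrefl i≡n+1 (ascentIndex<n+1 inAsc))
  ...   | no  _     = insertOne-removeOne positive x≢1 inAsc

record RFAWord (n k a : ℕ) (s' : List ℕ) (i : ℕ) : Set where
  field
    inQ       : InQ (n + 1) (a ∷ s')
    positive  : Positive (a ∷ s')
    ascents≡k : ascentsFrom a s' ≡ k
    range     : (1 ≤ i × i ≤ k) ⊎ i ≡ n + 1
    pos≤i     : pos (n + 1) (a ∷ s') ≤ i

rFAWord : ∀ {n k a s' i} → RFA n k (a ∷ s' , i) → RFAWord n k a s' i
rFAWord {a = a} {s'} (inQ , asc≡k , range , pos∸1<i) = record
  { inQ       = inQ
  ; positive  = All.map proj₁ (proj₁ (proj₂ (proj₁ inQ)))
  ; ascents≡k = trans (sym (asc≡ascents (a ∷ s') (proj₁ (proj₁ inQ)))) asc≡k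
  ; range     = range
  ; pos≤i     = ∸1<⇒≤ pos∸1<i
  }

module RFAWordProperties {n k a s' i} (word : RFAWord n k a s' i) where
  open RFAWord word

  length-σ : length (a ∷ s') ≡ n + 1
  length-σ = proj₁ (proj₁ inQ)

  oneFree : OneFree (map suc (a ∷ s'))
  oneFree = oneFree-map-suc positive

  append1-pos : pos 1 (map suc (a ∷ s') ++ 1 ∷ []) ≡ n + 2
  append1-pos = begin
    pos 1 (map suc (a ∷ s') ++ 1 ∷ [])  ≡⟨ pos-++-[1] oneFree ⟩
    suc (length (map suc (a ∷ s')))     ≡⟨ cong suc (trans (length-map suc (a ∷ s')) length-σ) ⟩
    suc (n + 1)                         ≡⟨ sym (+-suc n 1) ⟩
    n + 2                               ∎
    where open ≡-Reasoning

  append1-sound : RAbar n k (map suc (a ∷ s') ++ 1 ∷ [])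
  append1-sound = inQ′ , asc≡k , inj₁ append1-pos
    where
    inQ′ : InQ (n + 2) (map suc (a ∷ s') ++ 1 ∷ [])
    inQ′ = subst (λ m → InQ m (map suc (a ∷ s') ++ 1 ∷ [])) (sym (+-suc n 1)) (inQ-append1 inQ)
    asc≡k : asc (n + 2) (map suc (a ∷ s') ++ 1 ∷ []) ≡ k
    asc≡k = begin
      asc (n + 2) (suc a ∷ map suc s' ++ 1 ∷ [])   ≡⟨ asc≡ascents _ (proj₁ (proj₁ inQ′)) ⟩
      ascentsFrom (suc a) (map suc s' ++ 1 ∷ [])   ≡⟨ ascentsFrom-++-[1] (s≤s z≤n) (positive-map-suc s') ⟩
      ascentsFrom (suc a) (map suc s')             ≡⟨ ascentsFrom-map-suc a s' ⟩
      ascentsFrom a s'                             ≡⟨ ascents≡k ⟩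
      k                                            ∎
      where open ≡-Reasoning

  module Inserted (1≤i : 1 ≤ i) (i≤k : i ≤ k) where
    i≤ascents : i ≤ ascentsFrom (suc a) (map suc s')
    i≤ascents = subst (i ≤_) (sym (trans (ascentsFrom-map-suc a s') ascents≡k)) i≤k

    1+a≢1 : suc a ≢ 1
    1+a≢1 = >⇒≢ (s≤s (All.head positive))

    inAsc : OneInAscent (suc a) (insertOneFrom i (suc a) (map suc s'))
    inAsc = oneInAscent-insertOneFrom i (suc a) (map suc s') (All.tail oneFree) 1≤i i≤ascents

    inQ′ : InQ (n + 2) (suc a ∷ insertOneFrom i (suc a) (map suc s'))
    inQ′ = subst (λ m → InQ m (suc a ∷ insertOneFrom i (suc a) (map suc s'))) (sym (+-suc n 1))
             (inQ-insertOne inQ 1≤i (subst (i ≤_) (sym ascents≡k) i≤k) pos≤i)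

    interior : InteriorOne n (suc a ∷ insertOneFrom i (suc a) (map suc s'))
    interior = oneInAscent⇒interiorOne 1+a≢1 (suc-injective (trans (proj₁ (proj₁ inQ′)) (+-suc n 1))) inAsc

    inserted-sound : RAbar n k (suc a ∷ insertOneFrom i (suc a) (map suc s'))
    inserted-sound = inQ′ , asc≡k , inj₂ interior
      where
      asc≡k : asc (n + 2) (suc a ∷ insertOneFrom i (suc a) (map suc s')) ≡ k
      asc≡k = begin
        asc (n + 2) (suc a ∷ insertOneFrom i (suc a) (map suc s'))
          ≡⟨ asc≡ascents (suc a ∷ insertOneFrom i (suc a) (map suc s')) (proj₁ (proj₁ inQ′)) ⟩
        ascentsFrom (suc a) (insertOneFrom i (suc a) (map suc s'))
          ≡⟨ ascentsFrom-insertOneFrom i (suc a) (map suc s') (positive-map-suc s') (All.tail oneFree)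
                                       (s≤s z≤n) 1≤i i≤ascents ⟩
        ascentsFrom (suc a) (map suc s')
          ≡⟨ trans (ascentsFrom-map-suc a s') ascents≡k ⟩
        k ∎
        where open ≡-Reasoning

    removeOne-inserted : removeOne (suc a ∷ insertOneFrom i (suc a) (map suc s')) ≡ a ∷ s'
    removeOne-inserted =
      trans (removeOne-∷ _ 1+a≢1)
            (cong (a ∷_) (trans (removeOne-insertOneFrom i (suc a) (map suc s') (All.tail oneFree))
                                (map-pred-map-suc s')))

  sound : RAbar n k (RFA→RAbar n (a ∷ s' , i))
  sound with i ≟ n + 1
  ... | yes _ = append1-sound
  ... | no i≢n+1 with range
  ...   | inj₂ i≡n+1      = ⊥-elim (i≢n+1 i≡n+1)
  ...   | inj₁ (1≤i , i≤k) = Inserted.inserted-sound 1≤i i≤k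

  inverse : RAbar→RFA n (RFA→RAbar n (a ∷ s' , i)) ≡ (a ∷ s' , i)
  inverse with i ≟ n + 1
  ... | yes i≡n+1 with pos 1 (map suc (a ∷ s') ++ 1 ∷ []) ≟ n + 2
  ...   | yes _ = cong₂ _,_ (trans (removeOne-++-[1] oneFree) (map-pred-map-suc (a ∷ s'))) (sym i≡n+1)
  ...   | no p≢ = ⊥-elim (p≢ append1-pos)
  inverse | no i≢n+1 with range
  ...   | inj₂ i≡n+1      = ⊥-elim (i≢n+1 i≡n+1)
  ...   | inj₁ (1≤i , i≤k) with pos 1 (suc a ∷ insertOneFrom i (suc a) (map suc s')) ≟ n + 2
  ...     | yes p≡ = ⊥-elim (≤n+1⇒≢n+2 (proj₁ (proj₂ (Inserted.interior 1≤i i≤k))) p≡)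
  ...     | no  _  = cong₂ _,_ (Inserted.removeOne-inserted 1≤i i≤k)
                             (ascentIndexFrom-insertOneFrom i (suc a) (map suc s') (All.tail oneFree) 1≤i
                                                            (Inserted.i≤ascents 1≤i i≤k))

RAbar-nonempty : ∀ {n k} → ¬ RAbar n k []
RAbar-nonempty {n} (((0≡n+2 , _) , _) , _) with trans 0≡n+2 (+-comm n 2)
... | ()

RFA-nonempty : ∀ {n k i} → ¬ RFA n k ([] , i)
RFA-nonempty {n} (((0≡n+1 , _) , _) , _) with trans 0≡n+1 (+-comm n 1)
... | ()

RAbar→RFA-sound : ∀ n k w → RAbar n k w → RFA n k (RAbar→RFA n w)
RAbar→RFA-sound n k []       r = ⊥-elim (RAbar-nonempty r)
RAbar→RFA-sound n k (x ∷ xs) r = RAbarWordProperties.sound (rAbarWord r)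

RFA→RAbar∘RAbar→RFA : ∀ n k w → RAbar n k w → RFA→RAbar n (RAbar→RFA n w) ≡ w
RFA→RAbar∘RAbar→RFA n k []       r = ⊥-elim (RAbar-nonempty r)
RFA→RAbar∘RAbar→RFA n k (x ∷ xs) r = RAbarWordProperties.inverse (rAbarWord r)

RFA→RAbar-sound : ∀ n k σ i → RFA n k (σ , i) → RAbar n k (RFA→RAbar n (σ , i))
RFA→RAbar-sound n k []       i r = ⊥-elim (RFA-nonempty r)
RFA→RAbar-sound n k (a ∷ s') i r = RFAWordProperties.sound (rFAWord r)

RAbar→RFA∘RFA→RAbar : ∀ n k σ i → RFA n k (σ , i) → RAbar→RFA n (RFA→RAbar n (σ , i)) ≡ (σ , i)
RAbar→RFA∘RFA→RAbar n k []       i r = ⊥-elim (RFA-nonempty r)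
RAbar→RFA∘RFA→RAbar n k (a ∷ s') i r = RFAWordProperties.inverse (rFAWord r)

subset-≡ : ∀ {A : Set} {P : A → Set} (P? : Decidable P) {a b} {ta : True (P? a)} {tb : True (P? b)} →
           a ≡ b → (a , ta) ≡ (b , tb)
subset-≡ P? {a} {ta = ta} {tb} refl = cong (a ,_) (T-irrelevant ta tb)

lemma2p9 : (n k : ℕ) → RAbarSet n k ⤖ RFASet n k
lemma2p9 n k = ↔⇒⤖ (mk↔ₛ′ to from to∘from from∘to)
  where
  to : RAbarSet n k → RFASet n k
  to (w , t) = RAbar→RFA n w , fromWitness (RAbar→RFA-sound n k w (toWitness t))
  from : RFASet n k → RAbarSet n k
  from ((σ , i) , t) = RFA→RAbar n (σ , i) , fromWitness (RFA→RAbar-sound n k σ i (toWitness t))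
  to∘from : ∀ p → to (from p) ≡ p
  to∘from ((σ , i) , t) = subset-≡ (RFA? n k) (RAbar→RFA∘RFA→RAbar n k σ i (toWitness t))
  from∘to : ∀ w → from (to w) ≡ w
  from∘to (w , t) = subset-≡ (RAbar? n k) (RFA→RAbar∘RAbar→RFA n k w (toWitness t))
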